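{- For $n=3,4,5$, there do not exist rational $5$-designs with $n$ points for the Hermite measure $e^{ -t^2}dt/\sqrt{\pi}$ on $(-\infty,\infty)$.
   Context: An $m$-design with $n$ points for a probability measure $w(t)dt$ on an interval $I$ is a set of $n$ pairwise distinct points $x_1,\dots,x_n\in I$ with $\frac1n\sum_i f(x_i)=\int_I f(t)w(t)dt$ for every real polynomial $f$ of degree at most $m$; it is rational if all $x_i\in\mathbb{Q}$. -}

module Defs where

open import Data.Nat as ℕ using (ℕ; zero; suc; NonZero)
open import Data.Integer using (+_)
open import Data.Fin using (Fin; zero; suc; toℕ)
open import Data.Rational using (ℚ; 0ℚ; 1ℚ; _+_; _*_; _/_)
open import Data.Product using (Σ; _×_)
open import Function.Definitions using (Injective)
open import Relation.Binary.PropositionalEquality using (_≡_)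

infixr 8 _^_
_^_ : ℚ → ℕ → ℚ
x ^ zero  = 1ℚ
x ^ suc k = x * (x ^ k)

sumFin : (n : ℕ) → (Fin n → ℚ) → ℚ
sumFin zero    f = 0ℚ
sumFin (suc n) f = f zero + sumFin n (λ i → f (suc i))

-- A real polynomial of degree ≤ m, represented by its coefficients c₀ … c_m.
-- (Rational coefficients.)
Poly : ℕ → Set
Poly m = Fin (suc m) → ℚ

eval : {m : ℕ} → Poly m → ℚ → ℚ
eval {m} c x = sumFin (suc m) (λ k → c k * (x ^ toℕ k))

-- Moments ∫ t^k e^{-t²} dt / √π of the Hermite (Gaussian) probability measure:
-- μ₀ = 1, μ₁ = 0, μ_{k+2} = (k+1)/2 · μ_k  (integration by parts).
hermiteMoment : ℕ → ℚ
hermiteMoment zero          = 1ℚ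
hermiteMoment (suc zero)    = 0ℚ
hermiteMoment (suc (suc k)) = ((+ suc k) / 2) * hermiteMoment k

-- ∫ f(t) e^{-t²} dt / √π for a polynomial f, by linearity of the integral.
hermiteIntegral : {m : ℕ} → Poly m → ℚ
hermiteIntegral {m} c = sumFin (suc m) (λ k → c k * hermiteMoment (toℕ k))

IsRationalHermiteDesign : (m n : ℕ) .{{_ : NonZero n}} → (Fin n → ℚ) → Set
IsRationalHermiteDesign m n x =
  Injective _≡_ _≡_ x ×
  ((f : Poly m) → ((+ 1) / n) * sumFin n (λ i → eval f (x i)) ≡ hermiteIntegral f)

-- By Newton's identities the power sums p₁ … pₙ of n numbers determine the monic polynomial
-- ∏ⱼ (t − xⱼ) of which they are the roots.  For a 5-design with n ≤ 5 points the power sums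
-- are n times the Hermite moments 0, ½, 0, ¾, 0, so the points are roots of 4t³ − 3t,
-- 4t⁴ − 4t² − 1 or 32t⁵ − 40t³ − 5t respectively; as the points are distinct, one of them is
-- not 0.  But a nonzero root t would give the rational square roots 2t of 3, 2t² − 1 of 2 or
-- 8t² − 5 of 35, while a rational square root of a natural number is a natural number.
module Submission where

open import Agda.Builtin.FromNat using (Number; fromNat)
open import Data.Empty using (⊥-elim)
open import Data.Fin using (Fin; zero; suc; toℕ)
open import Data.Fin.Properties using (0≢1+n)
open import Data.Fin.Patterns using (0F; 1F; 2F; 3F; 4F; 5F)
open import Data.Integer as ℤ using (+_)
import Data.Integer.Properties as ℤ
open import Data.Maybe using (Maybe; just; nothing)
open import Data.Nat as ℕ using (ℕ; zero; suc; NonZero; _≤_; _<_; s≤s)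
import Data.Nat.Literals as ℕ
open import Data.Nat.Coprimality as Coprime using (Coprime; coprime-divisor; 1-coprimeTo)
open import Data.Nat.Divisibility using (_∣_; divides; ∣-refl)
import Data.Nat.Properties as ℕ
open import Data.Product using (Σ; ∃-syntax; _,_)
open import Data.Rational using (ℚ; mkℚ; 0ℚ; 1ℚ; _+_; _*_; _-_; _/_; 1/_)
open import Data.Rational.Literals using (number; fromℤ)
open import Data.Rational.Properties
  using (+-*-commutativeRing; heytingCommutativeRing; _≟_
        ; +-identityˡ; +-identityʳ; +-inverseʳ; *-identityˡ; *-zeroˡ; *-zeroʳ; *-assoc
        ; *-inverseʳ; normalize-coprime; toℚᵘ-homo-*; toℚᵘ-cong)
open import Data.Rational.Unnormalised using (*≡*)
open import Data.Rational.Unnormalised.Properties using (≃-trans; ≃-sym)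
open import Data.Unit using (tt)
open import Function.Definitions using (Injective)
open import Level using (0ℓ)
open import Relation.Binary.PropositionalEquality
open import Relation.Nullary using (¬_; yes; no)
open import Algebra.Apartness.Properties.HeytingCommutativeRing heytingCommutativeRing
  using (x#0y#0→xy#0)
open import Algebra.Bundles using (CommutativeRing)
open import Algebra.Properties.Semiring.Exp.TCOptimised (CommutativeRing.semiring +-*-commutativeRing)
  using (^-homo-*)
import Tactic.RingSolver.Core.AlmostCommutativeRing as ACR
open import Tactic.RingSolver using (solve-∀)

open import Defs hiding (_^_)

-- Numeric literals at ℕ and ℚ need fromNat and tt (their constraint is ⊤) in scope.
instance
  ℕ-number : Number ℕ
  ℕ-number = ℕ.number
  ℚ-number : Number ℚ
  ℚ-number = number

ℚ-ring : ACR.AlmostCommutativeRing 0ℓ 0ℓ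
ℚ-ring = ACR.fromCommutativeRing +-*-commutativeRing isZero
  where
  isZero : (x : ℚ) → Maybe (0ℚ ≡ x)
  isZero x with 0ℚ ≟ x
  ... | yes 0≡x = just 0≡x
  ... | no _    = nothing

-- The ring solver understands this power, but not Defs._^_.
open ACR.AlmostCommutativeRing ℚ-ring using (_^_)

Defs-^≡^ : ∀ x k → x Defs.^ k ≡ x ^ k
Defs-^≡^ x zero    = refl
Defs-^≡^ x (suc k) = trans (cong (x *_) (Defs-^≡^ x k)) (sym (^-homo-* x 1 k))

sumFin-cong : ∀ {n} {f g : Fin n → ℚ} → (∀ i → f i ≡ g i) → sumFin n f ≡ sumFin n g
sumFin-cong {zero}  f≗g = refl
sumFin-cong {suc n} f≗g = cong₂ _+_ (f≗g zero) (sumFin-cong (λ i → f≗g (suc i)))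

-- As an element of Poly m, δ k is the monomial t ^ toℕ k.
δ : ∀ {n} → Fin n → Fin n → ℚ
δ zero    zero    = 1ℚ
δ zero    (suc _) = 0ℚ
δ (suc _) zero    = 0ℚ
δ (suc i) (suc j) = δ i j

sumFin-0* : ∀ n (f : Fin n → ℚ) → sumFin n (λ j → 0ℚ * f j) ≡ 0ℚ
sumFin-0* zero    f = refl
sumFin-0* (suc n) f = cong₂ _+_ (*-zeroˡ (f zero)) (sumFin-0* n (λ j → f (suc j)))

sumFin-δ : ∀ {n} (i : Fin n) (f : Fin n → ℚ) → sumFin n (λ j → δ i j * f j) ≡ f i
sumFin-δ {suc n} zero f =
  trans (cong₂ _+_ (*-identityˡ (f zero)) (sumFin-0* n (λ j → f (suc j)))) (+-identityʳ (f zero))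
sumFin-δ {suc n} (suc i) f =
  trans (cong₂ _+_ (*-zeroˡ (f zero)) (sumFin-δ i (λ j → f (suc j)))) (+-identityˡ (f (suc i)))

prodFin : (n : ℕ) → (Fin n → ℚ) → ℚ
prodFin zero    f = 1ℚ
prodFin (suc n) f = f zero * prodFin n (λ i → f (suc i))

prodFin-zero : ∀ {n} (f : Fin n → ℚ) (i : Fin n) → f i ≡ 0ℚ → prodFin n f ≡ 0ℚ
prodFin-zero {suc n} f zero fᵢ≡0 =
  trans (cong (_* prodFin n (λ j → f (suc j))) fᵢ≡0) (*-zeroˡ (prodFin n (λ j → f (suc j))))
prodFin-zero f (suc i) fᵢ≡0 =
  trans (cong (f zero *_) (prodFin-zero (λ j → f (suc j)) i fᵢ≡0)) (*-zeroʳ (f zero))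

prodFin-vanishes : ∀ {n} (x : Fin n → ℚ) (i : Fin n) → prodFin n (λ j → x i - x j) ≡ 0ℚ
prodFin-vanishes x i = prodFin-zero (λ j → x i - x j) i (+-inverseʳ (x i))

powerSum : (n : ℕ) → (Fin n → ℚ) → ℕ → ℚ
powerSum n x k = sumFin n (λ i → x i ^ k)

design⇒powerMean : ∀ {m n} .{{_ : NonZero n}} {x : Fin n → ℚ} → IsRationalHermiteDesign m n x →
  (k : Fin (suc m)) → + 1 / n * powerSum n x (toℕ k) ≡ hermiteMoment (toℕ k)
design⇒powerMean {n = n} {x} (_ , exact) k = begin
  + 1 / n * powerSum n x (toℕ k)               ≡⟨ cong (+ 1 / n *_) (sumFin-cong eval-δ) ⟨
  + 1 / n * sumFin n (λ i → eval (δ k) (x i))  ≡⟨ exact (δ k) ⟩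
  hermiteIntegral (δ k)                        ≡⟨ sumFin-δ k (λ j → hermiteMoment (toℕ j)) ⟩
  hermiteMoment (toℕ k)                        ∎
  where
  open ≡-Reasoning
  eval-δ : ∀ i → eval (δ k) (x i) ≡ x i ^ toℕ k
  eval-δ i = trans (sumFin-δ k (λ j → x i Defs.^ toℕ j)) (Defs-^≡^ (x i) (toℕ k))

1/n*s≡r⇒s≡n*r : ∀ n .{{_ : NonZero n}} {s r : ℚ} → + 1 / n * s ≡ r → s ≡ fromℤ (+ n) * r
1/n*s≡r⇒s≡n*r (suc n) {s} refl = begin
  s                   ≡⟨ *-identityˡ s ⟨
  1ℚ * s              ≡⟨ cong (_* s) (*-inverseʳ n′) ⟨
  n′ * 1/ n′ * s      ≡⟨ *-assoc n′ (1/ n′) s ⟩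
  n′ * (1/ n′ * s)    ≡⟨ cong (λ r → n′ * (r * s)) (normalize-coprime (1-coprimeTo (suc n))) ⟨
  n′ * (+ 1 / suc n * s) ∎
  where
  open ≡-Reasoning
  n′ : ℚ
  n′ = fromℤ (+ suc n)

design⇒powerSum : ∀ {m n} .{{_ : NonZero n}} {x : Fin n → ℚ} → IsRationalHermiteDesign m n x →
  (k : Fin (suc m)) → powerSum n x (toℕ k) ≡ fromℤ (+ n) * hermiteMoment (toℕ k)
design⇒powerSum {n = n} D k = 1/n*s≡r⇒s≡n*r n (design⇒powerMean D k)

-- The elementary symmetric polynomials of k or more numbers in terms of their power sums p₁ … p_k
-- (Newton's identities).  INLINE lets the ring solver see through these definitions.
e₁ : ℚ → ℚ
e₁ p₁ = p₁
{-# INLINE e₁ #-}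

e₂ : ℚ → ℚ → ℚ
e₂ p₁ p₂ = 1/ 2 * (p₁ ^ 2 - p₂)
{-# INLINE e₂ #-}

e₃ : ℚ → ℚ → ℚ → ℚ
e₃ p₁ p₂ p₃ = 1/ 6 * (p₁ ^ 3 - 3 * p₁ * p₂ + 2 * p₃)
{-# INLINE e₃ #-}

e₄ : ℚ → ℚ → ℚ → ℚ → ℚ
e₄ p₁ p₂ p₃ p₄ = 1/ 24 * (p₁ ^ 4 - 6 * p₁ ^ 2 * p₂ + 3 * p₂ ^ 2 + 8 * p₁ * p₃ - 6 * p₄)
{-# INLINE e₄ #-}

e₅ : ℚ → ℚ → ℚ → ℚ → ℚ → ℚ
e₅ p₁ p₂ p₃ p₄ p₅ = 1/ 120 * (p₁ ^ 5 - 10 * p₁ ^ 3 * p₂ + 15 * p₁ * p₂ ^ 2 + 20 * p₁ ^ 2 * p₃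
                              - 20 * p₂ * p₃ - 30 * p₁ * p₄ + 24 * p₅)
{-# INLINE e₅ #-}

newtonPolynomial₃ : ℚ → ℚ → ℚ → ℚ → ℚ
newtonPolynomial₃ t p₁ p₂ p₃ = t ^ 3 - e₁ p₁ * t ^ 2 + e₂ p₁ p₂ * t - e₃ p₁ p₂ p₃
{-# INLINE newtonPolynomial₃ #-}

newtonPolynomial₄ : ℚ → ℚ → ℚ → ℚ → ℚ → ℚ
newtonPolynomial₄ t p₁ p₂ p₃ p₄ =
  t ^ 4 - e₁ p₁ * t ^ 3 + e₂ p₁ p₂ * t ^ 2 - e₃ p₁ p₂ p₃ * t + e₄ p₁ p₂ p₃ p₄
{-# INLINE newtonPolynomial₄ #-}

newtonPolynomial₅ : ℚ → ℚ → ℚ → ℚ → ℚ → ℚ → ℚ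
newtonPolynomial₅ t p₁ p₂ p₃ p₄ p₅ =
  t ^ 5 - e₁ p₁ * t ^ 4 + e₂ p₁ p₂ * t ^ 3 - e₃ p₁ p₂ p₃ * t ^ 2 + e₄ p₁ p₂ p₃ p₄ * t
    - e₅ p₁ p₂ p₃ p₄ p₅
{-# INLINE newtonPolynomial₅ #-}

-- Each identity is the statement with prodFin and powerSum unfolded, which the ring solver can read.
newton₃ : (x : Fin 3 → ℚ) {p₁ p₂ p₃ : ℚ} →
  powerSum 3 x 1 ≡ p₁ → powerSum 3 x 2 ≡ p₂ → powerSum 3 x 3 ≡ p₃ →
  ∀ t → prodFin 3 (λ j → t - x j) ≡ newtonPolynomial₃ t p₁ p₂ p₃
newton₃ x refl refl refl t = identity t (x 0F) (x 1F) (x 2F)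
  where
  identity : ∀ t a b c → let p k = a ^ k + (b ^ k + (c ^ k + 0ℚ)) in
    (t - a) * ((t - b) * ((t - c) * 1ℚ)) ≡ newtonPolynomial₃ t (p 1) (p 2) (p 3)
  identity = solve-∀ ℚ-ring

newton₄ : (x : Fin 4 → ℚ) {p₁ p₂ p₃ p₄ : ℚ} →
  powerSum 4 x 1 ≡ p₁ → powerSum 4 x 2 ≡ p₂ → powerSum 4 x 3 ≡ p₃ → powerSum 4 x 4 ≡ p₄ →
  ∀ t → prodFin 4 (λ j → t - x j) ≡ newtonPolynomial₄ t p₁ p₂ p₃ p₄
newton₄ x refl refl refl refl t = identity t (x 0F) (x 1F) (x 2F) (x 3F)
  where
  identity : ∀ t a b c d → let p k = a ^ k + (b ^ k + (c ^ k + (d ^ k + 0ℚ))) in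
    (t - a) * ((t - b) * ((t - c) * ((t - d) * 1ℚ))) ≡ newtonPolynomial₄ t (p 1) (p 2) (p 3) (p 4)
  identity = solve-∀ ℚ-ring

newton₅ : (x : Fin 5 → ℚ) {p₁ p₂ p₃ p₄ p₅ : ℚ} →
  powerSum 5 x 1 ≡ p₁ → powerSum 5 x 2 ≡ p₂ → powerSum 5 x 3 ≡ p₃ → powerSum 5 x 4 ≡ p₄ →
  powerSum 5 x 5 ≡ p₅ →
  ∀ t → prodFin 5 (λ j → t - x j) ≡ newtonPolynomial₅ t p₁ p₂ p₃ p₄ p₅
newton₅ x refl refl refl refl refl t = identity t (x 0F) (x 1F) (x 2F) (x 3F) (x 4F)
  where
  identity : ∀ t a b c d e → let p k = a ^ k + (b ^ k + (c ^ k + (d ^ k + (e ^ k + 0ℚ)))) in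
    (t - a) * ((t - b) * ((t - c) * ((t - d) * ((t - e) * 1ℚ))))
      ≡ newtonPolynomial₅ t (p 1) (p 2) (p 3) (p 4) (p 5)
  identity = solve-∀ ℚ-ring

hermiteDesign₃-root : {x : Fin 3 → ℚ} → IsRationalHermiteDesign 5 3 x →
  ∀ i → x i * (4 * x i ^ 2 - 3) ≡ 0ℚ
hermiteDesign₃-root {x} D i = begin
  x i * (4 * x i ^ 2 - 3)
    ≡⟨ at-moments (x i) ⟨
  4 * newtonPolynomial₃ (x i) (3 * hermiteMoment 1) (3 * hermiteMoment 2) (3 * hermiteMoment 3)
    ≡⟨ cong (4 *_) (newton₃ x (p 1F) (p 2F) (p 3F) (x i)) ⟨
  4 * prodFin 3 (λ j → x i - x j)
    ≡⟨ cong (4 *_) (prodFin-vanishes x i) ⟩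
  0ℚ ∎
  where
  open ≡-Reasoning
  p : (k : Fin 6) → powerSum 3 x (toℕ k) ≡ 3 * hermiteMoment (toℕ k)
  p = design⇒powerSum D
  at-moments : ∀ t → 4 * newtonPolynomial₃ t (3 * hermiteMoment 1) (3 * hermiteMoment 2) (3 * hermiteMoment 3)
                     ≡ t * (4 * t ^ 2 - 3)
  at-moments = solve-∀ ℚ-ring

hermiteDesign₄-root : {x : Fin 4 → ℚ} → IsRationalHermiteDesign 5 4 x →
  ∀ i → 4 * x i ^ 4 - 4 * x i ^ 2 - 1 ≡ 0ℚ
hermiteDesign₄-root {x} D i = begin
  4 * x i ^ 4 - 4 * x i ^ 2 - 1
    ≡⟨ at-moments (x i) ⟨
  4 * newtonPolynomial₄ (x i) (4 * hermiteMoment 1) (4 * hermiteMoment 2) (4 * hermiteMoment 3)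
                              (4 * hermiteMoment 4)
    ≡⟨ cong (4 *_) (newton₄ x (p 1F) (p 2F) (p 3F) (p 4F) (x i)) ⟨
  4 * prodFin 4 (λ j → x i - x j)
    ≡⟨ cong (4 *_) (prodFin-vanishes x i) ⟩
  0ℚ ∎
  where
  open ≡-Reasoning
  p : (k : Fin 6) → powerSum 4 x (toℕ k) ≡ 4 * hermiteMoment (toℕ k)
  p = design⇒powerSum D
  at-moments : ∀ t → 4 * newtonPolynomial₄ t (4 * hermiteMoment 1) (4 * hermiteMoment 2)
                                             (4 * hermiteMoment 3) (4 * hermiteMoment 4)
                     ≡ 4 * t ^ 4 - 4 * t ^ 2 - 1
  at-moments = solve-∀ ℚ-ring

hermiteDesign₅-root : {x : Fin 5 → ℚ} → IsRationalHermiteDesign 5 5 x →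
  ∀ i → x i * (32 * x i ^ 4 - 40 * x i ^ 2 - 5) ≡ 0ℚ
hermiteDesign₅-root {x} D i = begin
  x i * (32 * x i ^ 4 - 40 * x i ^ 2 - 5)
    ≡⟨ at-moments (x i) ⟨
  32 * newtonPolynomial₅ (x i) (5 * hermiteMoment 1) (5 * hermiteMoment 2) (5 * hermiteMoment 3)
                               (5 * hermiteMoment 4) (5 * hermiteMoment 5)
    ≡⟨ cong (32 *_) (newton₅ x (p 1F) (p 2F) (p 3F) (p 4F) (p 5F) (x i)) ⟨
  32 * prodFin 5 (λ j → x i - x j)
    ≡⟨ cong (32 *_) (prodFin-vanishes x i) ⟩
  0ℚ ∎
  where
  open ≡-Reasoning
  p : (k : Fin 6) → powerSum 5 x (toℕ k) ≡ 5 * hermiteMoment (toℕ k)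
  p = design⇒powerSum D
  at-moments : ∀ t → 32 * newtonPolynomial₅ t (5 * hermiteMoment 1) (5 * hermiteMoment 2)
                         (5 * hermiteMoment 3) (5 * hermiteMoment 4) (5 * hermiteMoment 5)
                     ≡ t * (32 * t ^ 4 - 40 * t ^ 2 - 5)
  at-moments = solve-∀ ℚ-ring

coprime-square⇒1 : ∀ {a b m} → Coprime a b → a ℕ.* a ≡ m ℕ.* (b ℕ.* b) → b ≡ 1
coprime-square⇒1 {a} {b} {m} a⊥b a²≡mb² = a⊥b (b∣a , ∣-refl)
  where
  b∣a : b ∣ a
  b∣a = coprime-divisor (Coprime.sym a⊥b) (divides (m ℕ.* b) (trans a²≡mb² (sym (ℕ.*-assoc m b b))))

rational-square⇒square : (q : ℚ) {m : ℕ} → q * q ≡ fromℤ (+ m) → ∃[ k ] k ℕ.* k ≡ m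
rational-square⇒square (mkℚ n d c) {m} q²≡m = ℤ.∣ n ∣ , (begin
  ℤ.∣ n ∣ ℕ.* ℤ.∣ n ∣      ≡⟨ n²≡md² ⟩
  m ℕ.* (suc d ℕ.* suc d)  ≡⟨ cong (λ b → m ℕ.* (b ℕ.* b)) d+1≡1 ⟩
  m ℕ.* 1                  ≡⟨ ℕ.*-identityʳ m ⟩
  m                        ∎)
  where
  open ≡-Reasoning
  n²≡md² : ℤ.∣ n ∣ ℕ.* ℤ.∣ n ∣ ≡ m ℕ.* (suc d ℕ.* suc d)
  n²≡md² with ≃-trans (≃-sym (toℚᵘ-homo-* (mkℚ n d c) (mkℚ n d c))) (toℚᵘ-cong q²≡m)
  ... | *≡* e = begin
    ℤ.∣ n ∣ ℕ.* ℤ.∣ n ∣                ≡⟨ ℕ.*-identityʳ _ ⟨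
    ℤ.∣ n ∣ ℕ.* ℤ.∣ n ∣ ℕ.* 1          ≡⟨ cong (ℕ._* 1) (ℤ.abs-* n n) ⟨
    ℤ.∣ n ℤ.* n ∣ ℕ.* 1                ≡⟨ ℤ.abs-* (n ℤ.* n) (+ 1) ⟨
    ℤ.∣ n ℤ.* n ℤ.* + 1 ∣              ≡⟨ cong ℤ.∣_∣ e ⟩
    ℤ.∣ + m ℤ.* + (suc d ℕ.* suc d) ∣  ≡⟨ ℤ.abs-* (+ m) _ ⟩
    m ℕ.* (suc d ℕ.* suc d)            ∎
  d+1≡1 : suc d ≡ 1
  d+1≡1 = coprime-square⇒1 {m = m} (Coprime.recompute c) n²≡md²

strictly-between-squares⇒¬square : ∀ k {m} → k ℕ.* k < m → m < suc k ℕ.* suc k → ∀ j → j ℕ.* j ≢ m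
strictly-between-squares⇒¬square k k²<m m<[1+k]² j refl with j ℕ.≤? k
... | yes j≤k = ℕ.<-irrefl refl (ℕ.≤-<-trans (ℕ.*-mono-≤ j≤k j≤k) k²<m)
... | no  j≰k = ℕ.<-irrefl refl (ℕ.<-≤-trans m<[1+k]² (ℕ.*-mono-≤ (ℕ.≰⇒> j≰k) (ℕ.≰⇒> j≰k)))

strictly-between-squares⇒irrational : ∀ k {m} → k ℕ.* k < m → m < suc k ℕ.* suc k →
  (q : ℚ) → q * q ≢ fromℤ (+ m)
strictly-between-squares⇒irrational k k²<m m<[1+k]² q q²≡m with rational-square⇒square q q²≡m
... | j , j²≡m = strictly-between-squares⇒¬square k k²<m m<[1+k]² j j²≡m

p*q≡0⇒q≡0 : ∀ {p q} → p ≢ 0ℚ → p * q ≡ 0ℚ → q ≡ 0ℚ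
p*q≡0⇒q≡0 {p} {q} p≢0 pq≡0 with q ≟ 0ℚ
... | yes q≡0 = q≡0
... | no  q≢0 = ⊥-elim (x#0y#0→xy#0 p≢0 q≢0 pq≡0)

injective⇒root-of-factor : ∀ {n} {x : Fin (suc (suc n)) → ℚ} (Q : ℚ → ℚ) → Injective _≡_ _≡_ x →
  (∀ i → x i * Q (x i) ≡ 0ℚ) → ∃[ i ] Q (x i) ≡ 0ℚ
injective⇒root-of-factor {x = x} Q injective roots with x 0F ≟ 0ℚ
... | no  x₀≢0 = 0F , p*q≡0⇒q≡0 x₀≢0 (roots 0F)
... | yes x₀≡0 = 1F , p*q≡0⇒q≡0 x₁≢0 (roots 1F)
  where
  x₁≢0 : x 1F ≢ 0ℚ
  x₁≢0 x₁≡0 = 0≢1+n (injective (trans x₀≡0 (sym x₁≡0)))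

4t²-3≢0 : ∀ t → 4 * t ^ 2 - 3 ≢ 0ℚ
4t²-3≢0 t root =
  strictly-between-squares⇒irrational 1 {3} (ℕ.<ᵇ⇒< 1 3 _) (ℕ.<ᵇ⇒< 3 4 _) (2 * t)
    (trans (square t) (cong (_+ 3) root))
  where
  square : ∀ t → 2 * t * (2 * t) ≡ 4 * t ^ 2 - 3 + 3
  square = solve-∀ ℚ-ring

4t⁴-4t²-1≢0 : ∀ t → 4 * t ^ 4 - 4 * t ^ 2 - 1 ≢ 0ℚ
4t⁴-4t²-1≢0 t root =
  strictly-between-squares⇒irrational 1 {2} (ℕ.<ᵇ⇒< 1 2 _) (ℕ.<ᵇ⇒< 2 4 _) (2 * t ^ 2 - 1)
    (trans (square t) (cong (_+ 2) root))
  where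
  square : ∀ t → (2 * t ^ 2 - 1) * (2 * t ^ 2 - 1) ≡ 4 * t ^ 4 - 4 * t ^ 2 - 1 + 2
  square = solve-∀ ℚ-ring

32t⁴-40t²-5≢0 : ∀ t → 32 * t ^ 4 - 40 * t ^ 2 - 5 ≢ 0ℚ
32t⁴-40t²-5≢0 t root =
  strictly-between-squares⇒irrational 5 {35} (ℕ.<ᵇ⇒< 25 35 _) (ℕ.<ᵇ⇒< 35 36 _) (8 * t ^ 2 - 5)
    (trans (square t) (cong (λ r → 2 * r + 35) root))
  where
  square : ∀ t → (8 * t ^ 2 - 5) * (8 * t ^ 2 - 5) ≡ 2 * (32 * t ^ 4 - 40 * t ^ 2 - 5) + 35
  square = solve-∀ ℚ-ring

¬hermiteDesign₃ : (x : Fin 3 → ℚ) → ¬ IsRationalHermiteDesign 5 3 x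
¬hermiteDesign₃ x D@(injective , _) =
  let i , root = injective⇒root-of-factor (λ t → 4 * t ^ 2 - 3) injective (hermiteDesign₃-root D)
  in 4t²-3≢0 (x i) root

¬hermiteDesign₄ : (x : Fin 4 → ℚ) → ¬ IsRationalHermiteDesign 5 4 x
¬hermiteDesign₄ x D = 4t⁴-4t²-1≢0 (x 0F) (hermiteDesign₄-root D 0F)

¬hermiteDesign₅ : (x : Fin 5 → ℚ) → ¬ IsRationalHermiteDesign 5 5 x
¬hermiteDesign₅ x D@(injective , _) =
  let i , root = injective⇒root-of-factor (λ t → 32 * t ^ 4 - 40 * t ^ 2 - 5) injective (hermiteDesign₅-root D)
  in 32t⁴-40t²-5≢0 (x i) root

theorem2p22 : (n : ℕ) .{{_ : NonZero n}} → 3 ≤ n → n ≤ 5 →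
    ¬ Σ (Fin n → ℚ) (λ x → IsRationalHermiteDesign 5 n x)
theorem2p22 1 (s≤s ())
theorem2p22 2 (s≤s (s≤s ()))
theorem2p22 3 _ _ (x , D) = ¬hermiteDesign₃ x D
theorem2p22 4 _ _ (x , D) = ¬hermiteDesign₄ x D
theorem2p22 5 _ _ (x , D) = ¬hermiteDesign₅ x D
theorem2p22 (suc (suc (suc (suc (suc (suc _)))))) _ (s≤s (s≤s (s≤s (s≤s (s≤s ())))))
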